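{- Let $\rho$ be a strict $n$-metric and let $G$ be a directed graph on the vertex set $[n]$ (without loops) which is admissible for $\rho$. Then for every $k\ge 1$ and every family of directed edges $(x_1,y_1),\dots,(x_k,y_k)$ of $G$ such that $x_1,\dots,x_k$ are pairwise distinct and $y_1,\dots,y_k$ are pairwise distinct, the $2k$ elements $x_1,\dots,x_k,y_1,\dots,y_k$ are pairwise distinct.
   Context: An $n$-metric is a real symmetric $n\times n$ matrix $\rho=(\rho_{ij})$ with $\rho_{ii}=0$, $\rho_{ij}>0$ for $i\neq j$, and $\rho_{ij}+\rho_{jk}\ge\rho_{ik}$ for all $i,j,k$. It is strict if $\rho_{ij}+\rho_{jk}>\rho_{ik}$ for all $i,k$ and all $j\in[n]\setminus\{i,k\}$. A directed graph $G$ on $[n]$ is called admissible for $\rho$ if for every $k\ge1$ and every family of directed edges $(x_i,y_i)$, $1\le i\le k$, of $G$ with the $x_i$ pairwise distinct and the $y_i$ pairwise distinct, one has $\sum_{i=1}^k\rho_{x_iy_i}\le\sum_{i=1}^k\rho_{x_iy_{i+1}}$, where $y_{k+1}=y_1$. (Equivalently, by a result of Gordon and Petrov, there is a facet of the polytope $\mathrm{conv}\{(e_i-e_j)/\rho_{ij}: i\neq j\}\subset\mathbb{R}^n$ containing all points $(e_i-e_j)/\rho_{ij}$ with $(i,j)$ an edge of $G$.) -}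

module Defs where

open import Data.Nat as ℕ using (ℕ; zero; suc; _%_)
open import Data.Nat.DivMod using (m%n<n)
open import Data.Fin using (Fin; toℕ; fromℕ<)
open import Data.Product using (Σ; _×_; ∃-syntax)
open import Data.Sum using (_⊎_)
open import Relation.Nullary using (¬_)
open import Relation.Binary.PropositionalEquality using (_≡_)
open import Relation.Binary.Structures using (IsStrictTotalOrder)
open import Algebra.Structures using (IsCommutativeRing)
open import Function.Definitions using (Injective)
import Data.Vec.Functional as VF

-- The real numbers, axiomatised: a complete ordered field.
-- (agda-stdlib has no reals; every model of this record is isomorphic
-- to ℝ, and we quantify over all models.)

record RealField : Set₁ where
  infixl 6 _+_
  infixl 7 _*_
  infix 4 _≈_ _<_ _≤_
  field
    Carrier : Set
    _≈_     : Carrier → Carrier → Set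
    _+_ _*_ : Carrier → Carrier → Carrier
    -_      : Carrier → Carrier
    0# 1#   : Carrier
    _<_     : Carrier → Carrier → Set
    isCommutativeRing : IsCommutativeRing _≈_ _+_ _*_ -_ 0# 1#
    isStrictTotalOrder : IsStrictTotalOrder _≈_ _<_
    0≉1     : ¬ (0# ≈ 1#)
    inverse : ∀ x → ¬ (x ≈ 0#) → ∃[ y ] (x * y ≈ 1#)
    +-monoˡ-< : ∀ {x y} z → x < y → x + z < y + z
    *-pos   : ∀ {x y} → 0# < x → 0# < y → 0# < x * y
    complete : (P : Carrier → Set) → (∃[ x ] P x) →
               (∃[ b ] (∀ x → P x → (x < b ⊎ x ≈ b))) →
               ∃[ s ] ((∀ x → P x → (x < s ⊎ x ≈ s)) ×
                       (∀ b → (∀ x → P x → (x < b ⊎ x ≈ b)) → (s < b ⊎ s ≈ b)))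

  _≤_ : Carrier → Carrier → Set
  x ≤ y = x < y ⊎ x ≈ y

module _ (R : RealField) where
  open RealField R

  Σ[_] : ∀ {k} → (Fin k → Carrier) → Carrier
  Σ[ f ] = VF.foldr _+_ 0# f

  record IsMetric (n : ℕ) (ρ : Fin n → Fin n → Carrier) : Set where
    field
      symmetric : ∀ i j → ρ i j ≈ ρ j i
      diag-zero : ∀ i → ρ i i ≈ 0#
      positive  : ∀ i j → ¬ (i ≡ j) → 0# < ρ i j
      triangle  : ∀ i j k → ρ i k ≤ ρ i j + ρ j k

  record IsStrictMetric (n : ℕ) (ρ : Fin n → Fin n → Carrier) : Set where
    field
      isMetric : IsMetric n ρ
      strict   : ∀ i j k → ¬ (j ≡ i) → ¬ (j ≡ k) → ρ i k < ρ i j + ρ j k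

  cyc : ∀ {m} → Fin (suc m) → Fin (suc m)
  cyc {m} i = fromℕ< (m%n<n (suc (toℕ i)) (suc m))

  -- Admissibility: for every k ≥ 1 (written k = suc m) and edges (x i, y i)
  -- of G with the x i pairwise distinct and the y i pairwise distinct,
  -- Σ ρ(x i, y i) ≤ Σ ρ(x i, y (i+1)), indices mod k.
  Admissible : (n : ℕ) → (Fin n → Fin n → Carrier) → (Fin n → Fin n → Set) → Set
  Admissible n ρ E =
    ∀ m (x y : Fin (suc m) → Fin n) →
      Injective _≡_ _≡_ x → Injective _≡_ _≡_ y → (∀ i → E (x i) (y i)) →
      Σ[ (λ i → ρ (x i) (y i)) ] ≤ Σ[ (λ i → ρ (x i) (y (cyc i))) ]

-- For two consecutive edges p → q → r of G (distinct sources and distinct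
-- targets, as G has no loops), admissibility with k = 2 gives
-- ρ(p,q) + ρ(q,r) ≤ ρ(p,r) + ρ(q,q) = ρ(p,r), contradicting the strict
-- triangle inequality. So G has no directed path of length two: no vertex is
-- both a head and a tail, hence the x's and the y's are disjoint.
module Submission where

open import Defs
open import Data.Nat using (ℕ; suc)
open import Data.Fin using (Fin; zero; suc; splitAt; join)
open import Data.Fin.Properties using (join-splitAt)
open import Data.Sum using (inj₁; inj₂; [_,_]′)
open import Data.Product using (proj₁; proj₂)
open import Data.Empty using (⊥)
open import Function using (_∘′_)
open import Level using (Level)
open import Relation.Nullary using (¬_)
open import Relation.Binary.PropositionalEquality using (_≡_; _≢_; refl; sym; cong; subst; ≢-sym; module ≡-Reasoning)
open import Relation.Binary.Structures using (IsStrictTotalOrder)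
open import Algebra.Structures using (IsCommutativeRing)
open import Function.Definitions using (Injective)
open import Function.Construct.Composition using (injective)
open import Data.Vec.Functional using (_++_; _∷_; [])
import Relation.Binary.Construct.StrictToNonStrict as StrictToNonStrict

private
  variable
    a b c : Level
    A : Set a
    B : Set b
    C : Set c

[,]-injective : {f : A → C} {g : B → C} →
                Injective _≡_ _≡_ f → Injective _≡_ _≡_ g → (∀ u v → f u ≢ g v) →
                Injective _≡_ _≡_ [ f , g ]′
[,]-injective f-inj g-inj f≢g {inj₁ u} {inj₁ u′} eq = cong inj₁ (f-inj eq)
[,]-injective f-inj g-inj f≢g {inj₁ u} {inj₂ v}  eq with () ← f≢g u v eq
[,]-injective f-inj g-inj f≢g {inj₂ v} {inj₁ u}  eq with () ← f≢g u v (sym eq)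
[,]-injective f-inj g-inj f≢g {inj₂ v} {inj₂ v′} eq = cong inj₂ (g-inj eq)

splitAt-injective : ∀ m {n} → Injective _≡_ _≡_ (splitAt m {n})
splitAt-injective m {n} {i} {j} eq = begin
  i                      ≡⟨ join-splitAt m n i ⟨
  join m n (splitAt m i) ≡⟨ cong (join m n) eq ⟩
  join m n (splitAt m j) ≡⟨ join-splitAt m n j ⟩
  j                      ∎
  where open ≡-Reasoning

++-injective-disjoint : ∀ {m n} {x : Fin m → A} {y : Fin n → A} →
                        Injective _≡_ _≡_ x → Injective _≡_ _≡_ y → (∀ u v → x u ≢ y v) →
                        Injective _≡_ _≡_ (x ++ y)
++-injective-disjoint {m = m} x-inj y-inj x≢y =
  injective _≡_ _≡_ _≡_ (splitAt-injective m) ([,]-injective x-inj y-inj x≢y)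

pair-injective : {p q : A} → p ≢ q → Injective _≡_ _≡_ (p ∷ q ∷ [])
pair-injective p≢q {zero}     {zero}     eq = refl
pair-injective p≢q {zero}     {suc zero} eq with () ← p≢q eq
pair-injective p≢q {suc zero} {zero}     eq with () ← p≢q (sym eq)
pair-injective p≢q {suc zero} {suc zero} eq = refl

module _ (R : RealField) where
  open RealField R hiding (_≤_)
  open IsCommutativeRing isCommutativeRing using (+-identityʳ; +-cong)
  open IsStrictTotalOrder isStrictTotalOrder
    using (isEquivalence; irrefl; trans; <-respʳ-≈; <-respˡ-≈; <-resp-≈; module Eq)
  open StrictToNonStrict _≈_ _<_ using (_≤_; <-≤-trans; ≤-resp-≈)

  <⇒≱ : ∀ {u v} → u < v → ¬ (v ≤ u)
  <⇒≱ u<v v≤u = irrefl Eq.refl (<-≤-trans trans <-respʳ-≈ u<v v≤u)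

  ≤-resp₂-≈ : ∀ {u u′ v v′} → u ≈ u′ → v ≈ v′ → u ≤ v → u′ ≤ v′
  ≤-resp₂-≈ u≈u′ v≈v′ = proj₂ ≤-resp u≈u′ ∘′ proj₁ ≤-resp v≈v′
    where ≤-resp = ≤-resp-≈ isEquivalence <-resp-≈

  module _ {n : ℕ} {ρ : Fin n → Fin n → Carrier} where

    admissible-exchange : ∀ {E} → Admissible R n ρ E →
                          ∀ {p q r s} → E p r → E q s → p ≢ q → r ≢ s →
                          ρ p r + ρ q s ≤ ρ p s + ρ q r
    admissible-exchange {E} adm {p} {q} {r} {s} epr eqs p≢q r≢s =
      ≤-resp₂-≈ drop-0# drop-0#
        (adm 1 (p ∷ q ∷ []) (r ∷ s ∷ []) (pair-injective p≢q) (pair-injective r≢s) edges)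
      where
      drop-0# : ∀ {u v} → u + (v + 0#) ≈ u + v
      drop-0# = +-cong Eq.refl (+-identityʳ _)
      edges : ∀ i → E ((p ∷ q ∷ []) i) ((r ∷ s ∷ []) i)
      edges zero       = epr
      edges (suc zero) = eqs

    strict-exchange : IsStrictMetric R n ρ → ∀ {p q r} → q ≢ p → q ≢ r →
                      ρ p r + ρ q q < ρ p q + ρ q r
    strict-exchange sm {p} {q} {r} q≢p q≢r =
      <-respˡ-≈ (Eq.sym ρqq-vanishes) (IsStrictMetric.strict sm p q r q≢p q≢r)
      where
      ρqq-vanishes : ρ p r + ρ q q ≈ ρ p r
      ρqq-vanishes = Eq.trans (+-cong Eq.refl (IsMetric.diag-zero (IsStrictMetric.isMetric sm) q))
                              (+-identityʳ _)

    admissible-no-path₂ : ∀ {E} → IsStrictMetric R n ρ → (∀ i → ¬ E i i) → Admissible R n ρ E →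
                          ∀ {p q r} → E p q → E q r → ⊥
    admissible-no-path₂ sm loopless adm {p} {q} {r} epq eqr =
      <⇒≱ (strict-exchange sm (≢-sym p≢q) q≢r) (admissible-exchange adm epq eqr p≢q q≢r)
      where
      p≢q : p ≢ q
      p≢q refl = loopless p epq
      q≢r : q ≢ r
      q≢r refl = loopless q eqr

lemma2p7 : (R : RealField) (n : ℕ) (ρ : Fin n → Fin n → RealField.Carrier R)
    (E : Fin n → Fin n → Set) →
    IsStrictMetric R n ρ → (∀ i → ¬ E i i) → Admissible R n ρ E →
    ∀ m (x y : Fin (suc m) → Fin n) →
    Injective _≡_ _≡_ x → Injective _≡_ _≡_ y → (∀ i → E (x i) (y i)) →
    Injective _≡_ _≡_ (x ++ y)
lemma2p7 R n ρ E sm loopless adm m x y x-inj y-inj edge =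
  ++-injective-disjoint x-inj y-inj x≢y
  where
  x≢y : ∀ a b → x a ≢ y b
  x≢y a b xa≡yb =
    admissible-no-path₂ R {E = E} sm loopless adm (edge b) (subst (λ v → E v (y a)) xa≡yb (edge a))
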